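{- Let $G$ be a forbidden induced subgraph for the class of edge-apex cographs. Then $G$ contains more than one induced $P_4$ (that is, there are at least two distinct vertex subsets of $G$ each inducing a subgraph isomorphic to $P_4$).
   Context: All graphs are finite, simple and undirected. $P_4$ is the path on four vertices. A cograph is a graph with no induced subgraph isomorphic to $P_4$ (equivalently, generated from $K_1$ by complementation and disjoint union). A graph $G$ is an edge-apex cograph if $G$ is a cograph or $G$ has an edge $e$ such that $G-e$ (delete the edge, keep all vertices) is a cograph. A forbidden induced subgraph for the class of edge-apex cographs is a graph that is not an edge-apex cograph but all of whose proper induced subgraphs are edge-apex cographs. -}

module Defs where

open import Data.Nat using (ℕ; _<_)
open import Data.Fin using (Fin; zero; suc; _≟_)
open import Data.Bool using (Bool; true; false; _∧_; _∨_; not)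
open import Data.Product using (Σ; ∃; _×_; _,_)
open import Data.Sum using (_⊎_)
open import Relation.Nullary using (¬_)
open import Relation.Nullary.Decidable using (⌊_⌋)
open import Relation.Binary.PropositionalEquality using (_≡_; _≢_; refl; cong; cong₂; trans)
open import Data.Bool.Properties using (∨-comm; ∧-comm)
open import Function.Definitions using (Injective)

record Graph (n : ℕ) : Set where
  field
    adj    : Fin n → Fin n → Bool
    sym    : ∀ x y → adj x y ≡ adj y x
    irrefl : ∀ x → adj x x ≡ false
open Graph public

P4adj : Fin 4 → Fin 4 → Bool
P4adj zero (suc zero) = true
P4adj (suc zero) zero = true
P4adj (suc zero) (suc (suc zero)) = true
P4adj (suc (suc zero)) (suc zero) = true
P4adj (suc (suc zero)) (suc (suc (suc zero))) = true
P4adj (suc (suc (suc zero))) (suc (suc zero)) = true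
P4adj _ _ = false

InducedP4 : ∀ {n} → Graph n → (Fin 4 → Fin n) → Set
InducedP4 G f = Injective _≡_ _≡_ f × (∀ i j → adj G (f i) (f j) ≡ P4adj i j)

Cograph : ∀ {n} → Graph n → Set
Cograph G = ¬ (Σ (Fin 4 → Fin _) λ f → InducedP4 G f)

sameEdge : ∀ {n} → Fin n → Fin n → Fin n → Fin n → Bool
sameEdge u v x y = (⌊ x ≟ u ⌋ ∧ ⌊ y ≟ v ⌋) ∨ (⌊ x ≟ v ⌋ ∧ ⌊ y ≟ u ⌋)

deleteEdge : ∀ {n} → Graph n → Fin n → Fin n → Graph n
deleteEdge {n} G u v = record
  { adj = λ x y → adj G x y ∧ not (sameEdge u v x y)
  ; sym = symP
  ; irrefl = λ x → irr x }
  where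
  symP : ∀ x y → (adj G x y ∧ not (sameEdge u v x y)) ≡ (adj G y x ∧ not (sameEdge u v y x))
  symP x y = cong₂ _∧_ (Graph.sym G x y) (cong not (trans
                (∨-comm (⌊ x ≟ u ⌋ ∧ ⌊ y ≟ v ⌋) (⌊ x ≟ v ⌋ ∧ ⌊ y ≟ u ⌋))
                (cong₂ _∨_ (∧-comm ⌊ x ≟ v ⌋ ⌊ y ≟ u ⌋) (∧-comm ⌊ x ≟ u ⌋ ⌊ y ≟ v ⌋))))
  irr : ∀ x → (adj G x x ∧ not (sameEdge u v x x)) ≡ false
  irr x rewrite irrefl G x = refl

EdgeApexCograph : ∀ {n} → Graph n → Set
EdgeApexCograph {n} G =
  Cograph G ⊎ Σ (Fin n) λ u → Σ (Fin n) λ v → adj G u v ≡ true × Cograph (deleteEdge G u v)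

induced : ∀ {m n} → Graph n → (Fin m → Fin n) → Graph m
induced G f = record
  { adj = λ x y → adj G (f x) (f y)
  ; sym = λ x y → sym G (f x) (f y)
  ; irrefl = λ x → irrefl G (f x) }

ForbiddenEdgeApex : ∀ {n} → Graph n → Set
ForbiddenEdgeApex {n} G =
  ¬ EdgeApexCograph G ×
  (∀ m (f : Fin m → Fin n) → Injective _≡_ _≡_ f → m < n → EdgeApexCograph (induced G f))

{-# OPTIONS --safe #-}
-- Let a-b-c-d be an induced P4 of G; as G - ab is not
-- a cograph, it has an induced P4 h. If h misses a or b, it is an induced P4 of G
-- other than a-b-c-d. Otherwise a, b are non-adjacent on h, so h has a neighbour
-- z ≠ b of a, and z ∉ {a, b, c, d} since c and d miss a. Whatever the adjacencies
-- of z to b, c, d, some induced P4 of G passes through z, except when z sees all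
-- of a, b, c, d; then h = a-z-b-y, and y-b-z-d or y-d-z-a is induced in G.
module Submission where

open import Defs hiding (sym)
open import Data.Fin using (Fin; _≟_)
open import Data.Fin.Patterns using (0F; 1F; 2F; 3F)
open import Data.Fin.Properties using (any?; all?)
open import Data.Bool using (true; false; _∧_; _∨_; not)
open import Data.Bool.Properties using (∧-identityʳ; ∧-zeroʳ; not-¬) renaming (_≟_ to _≟ᵇ_)
open import Data.Vec using ([]; _∷_; lookup)
open import Data.Product using (Σ; Σ-syntax; _×_; _,_; proj₂)
open import Data.Sum using (_⊎_; inj₁; inj₂; [_,_])
open import Data.Empty using (⊥; ⊥-elim)
open import Function.Consequences.Propositional using (contraInjective)
open import Function.Definitions using (Injective)
open import Relation.Nullary using (¬_; Dec; yes; no; contradiction)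
open import Relation.Nullary.Decidable
  using (False; does; map′; toWitness; toWitnessFalse; isYes≗does; dec-true; dec-false; _×-dec_; _⊎-dec_; _→-dec_)
open import Relation.Binary.PropositionalEquality
  using (_≡_; _≢_; refl; sym; trans; cong; cong₂; module ≡-Reasoning)

open ≡-Reasoning

path : ∀ {A : Set} → A → A → A → A → Fin 4 → A
path a b c d = lookup (a ∷ b ∷ c ∷ d ∷ [])

_∉_ : ∀ {A : Set} {m} → A → (Fin m → A) → Set
x ∉ g = ∀ j → x ≢ g j

P4-twin-free : ∀ i j → (∀ k → P4adj i k ≡ P4adj j k) → i ≡ j
P4-twin-free = toWitness {a? = all? λ i → all? λ j →
  (all? λ k → P4adj i k ≟ᵇ P4adj j k) →-dec (i ≟ j)} _

sameEdge? : ∀ {n} (u v x y : Fin n) → Dec ((x ≡ u × y ≡ v) ⊎ (x ≡ v × y ≡ u))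
sameEdge? u v x y = (x ≟ u ×-dec y ≟ v) ⊎-dec (x ≟ v ×-dec y ≟ u)

sameEdge≡does : ∀ {n} (u v x y : Fin n) → sameEdge u v x y ≡ does (sameEdge? u v x y)
sameEdge≡does u v x y = cong₂ _∨_ (cong₂ _∧_ (isYes≗does (x ≟ u)) (isYes≗does (y ≟ v)))
                                  (cong₂ _∧_ (isYes≗does (x ≟ v)) (isYes≗does (y ≟ u)))

sameEdge-true : ∀ {n} (u v x y : Fin n) → (x ≡ u × y ≡ v) ⊎ (x ≡ v × y ≡ u) → sameEdge u v x y ≡ true
sameEdge-true u v x y same = trans (sameEdge≡does u v x y) (dec-true (sameEdge? u v x y) same)

sameEdge-false : ∀ {n} (u v x y : Fin n) → ¬ ((x ≡ u × y ≡ v) ⊎ (x ≡ v × y ≡ u)) → sameEdge u v x y ≡ false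
sameEdge-false u v x y ¬same = trans (sameEdge≡does u v x y) (dec-false (sameEdge? u v x y) ¬same)

module _ {n} (G : Graph n) where

  infix 4 _~_ _≁_
  _~_ _≁_ : Fin n → Fin n → Set
  x ~ y = adj G x y ≡ true
  x ≁ y = adj G x y ≡ false

  adj-swap : ∀ {x y β} → adj G x y ≡ β → adj G y x ≡ β
  adj-swap {x} {y} = trans (Graph.sym G y x)

  ~-or-≁ : ∀ x y → x ~ y ⊎ x ≁ y
  ~-or-≁ x y with adj G x y
  ... | true  = inj₁ refl
  ... | false = inj₂ refl

  ~-≁⇒≢ : ∀ {x y w} → x ~ w → y ≁ w → x ≢ y
  ~-≁⇒≢ x~w y≁w refl = not-¬ y≁w x~w

  adj⇒InducedP4 : ∀ {g} → (∀ i j → adj G (g i) (g j) ≡ P4adj i j) → InducedP4 G g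
  adj⇒InducedP4 {g} g-adj = injective , g-adj
    where
    injective : ∀ {i j} → g i ≡ g j → i ≡ j
    injective {i} {j} gi≡gj = P4-twin-free i j λ k → begin
      P4adj i k          ≡⟨ sym (g-adj i k) ⟩
      adj G (g i) (g k)  ≡⟨ cong (λ x → adj G x (g k)) gi≡gj ⟩
      adj G (g j) (g k)  ≡⟨ g-adj j k ⟩
      P4adj j k          ∎

  inducedPath : ∀ {a b c d} → a ~ b → b ~ c → c ~ d → a ≁ c → a ≁ d → b ≁ d →
                InducedP4 G (path a b c d)
  inducedPath {a} {b} {c} {d} ab bc cd ac ad bd = adj⇒InducedP4 table
    where
    table : ∀ i j → adj G (path a b c d i) (path a b c d j) ≡ P4adj i j
    table 0F 0F = irrefl G a
    table 0F 1F = ab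
    table 0F 2F = ac
    table 0F 3F = ad
    table 1F 0F = adj-swap ab
    table 1F 1F = irrefl G b
    table 1F 2F = bc
    table 1F 3F = bd
    table 2F 0F = adj-swap ac
    table 2F 1F = adj-swap bc
    table 2F 2F = irrefl G c
    table 2F 3F = cd
    table 3F 0F = adj-swap ad
    table 3F 1F = adj-swap bd
    table 3F 2F = adj-swap cd
    table 3F 3F = irrefl G d

  InducedP4-path : ∀ {f} → InducedP4 G f → InducedP4 G (path (f 0F) (f 1F) (f 2F) (f 3F))
  InducedP4-path (_ , f-adj) =
    inducedPath (f-adj 0F 1F) (f-adj 1F 2F) (f-adj 2F 3F) (f-adj 0F 2F) (f-adj 0F 3F) (f-adj 1F 3F)

  inducedP4? : Dec (Σ (Fin 4 → Fin n) (InducedP4 G))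
  inducedP4? = map′ (λ (a , b , c , d , P) → path a b c d , P)
                    (λ (f , P) → f 0F , f 1F , f 2F , f 3F , InducedP4-path P)
                    (any? λ a → any? λ b → any? λ c → any? λ d → inducedPath? a b c d)
    where
    inducedPath? : ∀ a b c d → Dec (InducedP4 G (path a b c d))
    inducedPath? a b c d = map′ adj⇒InducedP4 proj₂
      (all? λ i → all? λ j → adj G (path a b c d i) (path a b c d j) ≟ᵇ P4adj i j)

  deleteEdge-adj-deleted : ∀ u v → adj (deleteEdge G u v) u v ≡ false
  deleteEdge-adj-deleted u v = begin
    adj G u v ∧ not (sameEdge u v u v)  ≡⟨ cong (λ s → adj G u v ∧ not s)
                                                (sameEdge-true u v u v (inj₁ (refl , refl))) ⟩
    adj G u v ∧ false                   ≡⟨ ∧-zeroʳ (adj G u v) ⟩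
    false                               ∎

  deleteEdge-adj-kept : ∀ {u v x y} → ¬ (x ≡ u × y ≡ v) → ¬ (x ≡ v × y ≡ u) →
                        adj (deleteEdge G u v) x y ≡ adj G x y
  deleteEdge-adj-kept {u} {v} {x} {y} ¬uv ¬vu = begin
    adj G x y ∧ not (sameEdge u v x y)  ≡⟨ cong (λ s → adj G x y ∧ not s)
                                                (sameEdge-false u v x y [ ¬uv , ¬vu ]) ⟩
    adj G x y ∧ true                    ≡⟨ ∧-identityʳ (adj G x y) ⟩
    adj G x y                           ∎

  InducedP4-deleteEdge-avoiding : ∀ {u v h} → (∀ i j → h i ≡ u → h j ≡ v → ⊥) →
                                  InducedP4 (deleteEdge G u v) h → InducedP4 G h
  InducedP4-deleteEdge-avoiding avoids (h-inj , h-adj) = h-inj , λ i j →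
    trans (sym (deleteEdge-adj-kept (λ (hi≡u , hj≡v) → avoids i j hi≡u hj≡v)
                                    (λ (hi≡v , hj≡u) → avoids j i hj≡u hi≡v)))
          (h-adj i j)

  deleteEdge-adj-restored : ∀ {h pa pb} → InducedP4 (deleteEdge G (h pa) (h pb)) h →
                            ∀ p q → {False (p ≟ pa)} → {False (p ≟ pb)} →
                            adj G (h p) (h q) ≡ P4adj p q
  deleteEdge-adj-restored (h-inj , h-adj) p q {p≢pa} {p≢pb} =
    trans (sym (deleteEdge-adj-kept (λ (e , _) → toWitnessFalse p≢pa (h-inj e))
                                    (λ (e , _) → toWitnessFalse p≢pb (h-inj e))))
          (h-adj p q)

  InducedP4Through : Fin n → Set
  InducedP4Through z = Σ[ g ∈ (Fin 4 → Fin n) ] InducedP4 G g × Σ[ i ∈ Fin 4 ] g i ≡ z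

  AnotherInducedP4 : (Fin 4 → Fin n) → Set
  AnotherInducedP4 f = Σ[ g ∈ (Fin 4 → Fin n) ] InducedP4 G g × Σ[ i ∈ Fin 4 ] g i ∉ f

  DistinctInducedP4s : Set
  DistinctInducedP4s = Σ[ f ∈ (Fin 4 → Fin n) ] Σ[ g ∈ (Fin 4 → Fin n) ]
                         InducedP4 G f × InducedP4 G g × Σ[ i ∈ Fin 4 ] f i ∉ g

  P4-through-end-neighbour : ∀ {a b c d z} → InducedP4 G (path a b c d) →
                             z ~ a → (z ~ d → z ≁ b) → InducedP4Through z
  P4-through-end-neighbour {a} {b} {c} {d} {z} (_ , p) za zd⇒zb
    with ~-or-≁ z d | ~-or-≁ z c | ~-or-≁ z b
  ... | inj₁ zd | _       | _       =
        path b a z d , inducedPath (p 1F 0F) (adj-swap za) zd (adj-swap (zd⇒zb zd)) (p 1F 3F) (p 0F 3F) ,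
        2F , refl
  ... | inj₂ zd | inj₁ zc | _       =
        path a z c d , inducedPath (adj-swap za) zc (p 2F 3F) (p 0F 2F) (p 0F 3F) zd , 1F , refl
  ... | inj₂ zd | inj₂ zc | inj₁ zb =
        path z b c d , inducedPath zb (p 1F 2F) (p 2F 3F) zc zd (p 1F 3F) , 0F , refl
  ... | inj₂ zd | inj₂ zc | inj₂ zb =
        path z a b c , inducedPath za (p 0F 1F) (p 1F 2F) zb zc (p 0F 2F) , 0F , refl

  P4-through-common-neighbour : ∀ {a b c d z y} → InducedP4 G (path a b c d) →
                                z ~ a → z ~ b → y ~ b → y ≁ a → y ≁ z → InducedP4Through z
  P4-through-common-neighbour {a} {b} {_} {d} {z} {y} P@(_ , p) za zb yb ya yz
    with ~-or-≁ z d | ~-or-≁ y d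
  ... | inj₂ zd | _       = P4-through-end-neighbour P za (λ zd′ → contradiction zd′ (not-¬ zd))
  ... | inj₁ zd | inj₁ yd =
        path y d z a , inducedPath yd (adj-swap zd) za yz ya (p 3F 0F) , 2F , refl
  ... | inj₁ zd | inj₂ yd =
        path y b z d , inducedPath yb (adj-swap zb) zd yz yd (p 1F 3F) , 2F , refl

  another-through-end-neighbour : ∀ {a b c d z} → InducedP4 G (path a b c d) → z ~ a → z ≢ b →
                                  InducedP4Through z → AnotherInducedP4 (path a b c d)
  another-through-end-neighbour (_ , p) za z≢b (g , g-P4 , i , refl) = g , g-P4 , i , λ where
    0F → ~-≁⇒≢ za (irrefl G _)
    1F → z≢b
    2F → ~-≁⇒≢ za (p 2F 0F)
    3F → ~-≁⇒≢ za (p 3F 0F)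

  another-from-positions : ∀ {h c d} pa pb → P4adj pa pb ≡ false → pa ≢ pb → Injective _≡_ _≡_ h →
                         (∀ p q → {False (p ≟ pa)} → {False (p ≟ pb)} → adj G (h p) (h q) ≡ P4adj p q) →
                         InducedP4 G (path (h pa) (h pb) c d) → AnotherInducedP4 (path (h pa) (h pb) c d)
  -- z = h p for a neighbour p of pa on h; when p is also next to pb, y is h's fourth vertex.
  another-from-positions 0F 2F _ _ h-inj h~ P =
    another-through-end-neighbour P (h~ 1F 0F) (contraInjective h-inj λ ())
      (P4-through-common-neighbour P (h~ 1F 0F) (h~ 1F 2F) (h~ 3F 2F) (h~ 3F 0F) (h~ 3F 1F))
  another-from-positions 3F 1F _ _ h-inj h~ P =
    another-through-end-neighbour P (h~ 2F 3F) (contraInjective h-inj λ ())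
      (P4-through-common-neighbour P (h~ 2F 3F) (h~ 2F 1F) (h~ 0F 1F) (h~ 0F 3F) (h~ 0F 2F))
  another-from-positions 0F 3F _ _ h-inj h~ P =
    another-through-end-neighbour P (h~ 1F 0F) (contraInjective h-inj λ ())
      (P4-through-end-neighbour P (h~ 1F 0F) λ _ → h~ 1F 3F)
  another-from-positions 3F 0F _ _ h-inj h~ P =
    another-through-end-neighbour P (h~ 2F 3F) (contraInjective h-inj λ ())
      (P4-through-end-neighbour P (h~ 2F 3F) λ _ → h~ 2F 0F)
  another-from-positions 1F 3F _ _ h-inj h~ P =
    another-through-end-neighbour P (h~ 0F 1F) (contraInjective h-inj λ ())
      (P4-through-end-neighbour P (h~ 0F 1F) λ _ → h~ 0F 3F)
  another-from-positions 2F 0F _ _ h-inj h~ P =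
    another-through-end-neighbour P (h~ 3F 2F) (contraInjective h-inj λ ())
      (P4-through-end-neighbour P (h~ 3F 2F) λ _ → h~ 3F 0F)
  another-from-positions 0F 0F _ 0≢0 _ _ _ = contradiction refl 0≢0
  another-from-positions 1F 1F _ 1≢1 _ _ _ = contradiction refl 1≢1
  another-from-positions 2F 2F _ 2≢2 _ _ _ = contradiction refl 2≢2
  another-from-positions 3F 3F _ 3≢3 _ _ _ = contradiction refl 3≢3
  another-from-positions 0F 1F () _ _ _ _
  another-from-positions 1F 0F () _ _ _ _
  another-from-positions 1F 2F () _ _ _ _
  another-from-positions 2F 1F () _ _ _ _
  another-from-positions 2F 3F () _ _ _ _
  another-from-positions 3F 2F () _ _ _ _

  another-from-deleteEdge : ∀ {a b c d h pa pb} → InducedP4 G (path a b c d) → InducedP4 (deleteEdge G a b) h →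
                            h pa ≡ a → h pb ≡ b → AnotherInducedP4 (path a b c d)
  another-from-deleteEdge {h = h} {pa} {pb} P@(_ , p) Q@(h-inj , q) refl refl =
    another-from-positions pa pb pa≁pb pa≢pb h-inj (deleteEdge-adj-restored Q) P
    where
    pa≁pb : P4adj pa pb ≡ false
    pa≁pb = trans (sym (q pa pb)) (deleteEdge-adj-deleted (h pa) (h pb))
    pa≢pb : pa ≢ pb
    pa≢pb pa≡pb = ~-≁⇒≢ (p 0F 1F) (irrefl G (h pb)) (cong h pa≡pb)

  distinct-induced-P4s : ∀ {a b c d h} → InducedP4 G (path a b c d) → InducedP4 (deleteEdge G a b) h →
                         DistinctInducedP4s
  distinct-induced-P4s {a} {b} {c} {d} {h} P Q with any? (λ j → h j ≟ a) | any? (λ j → h j ≟ b)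
  ... | no a∉h | _ =
        path a b c d , h , P , InducedP4-deleteEdge-avoiding (λ i _ hi≡a _ → a∉h (i , hi≡a)) Q ,
        0F , λ j a≡hj → a∉h (j , sym a≡hj)
  ... | yes _ | no b∉h =
        path a b c d , h , P , InducedP4-deleteEdge-avoiding (λ _ j _ hj≡b → b∉h (j , hj≡b)) Q ,
        1F , λ j b≡hj → b∉h (j , sym b≡hj)
  ... | yes (pa , ha) | yes (pb , hb) =
        let g , g-P4 , i , gi∉P = another-from-deleteEdge P Q ha hb
        in  g , path a b c d , g-P4 , P , i , gi∉P

proposition3p3 : ∀ {n} (G : Graph n) → ForbiddenEdgeApex G →
    Σ (Fin 4 → Fin n) λ f → Σ (Fin 4 → Fin n) λ g →
      InducedP4 G f × InducedP4 G g × Σ (Fin 4) λ i → ∀ j → f i ≢ g j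
proposition3p3 G (notEdgeApex , _) with inducedP4? G
... | no cograph = ⊥-elim (notEdgeApex (inj₁ cograph))
... | yes (f , f-P4) with inducedP4? (deleteEdge G (f 0F) (f 1F))
...   | no cograph = ⊥-elim (notEdgeApex (inj₂ (f 0F , f 1F , proj₂ f-P4 0F 1F , cograph)))
...   | yes (h , h-P4) = distinct-induced-P4s G (InducedP4-path G f-P4) h-P4
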